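{- Let $\mathbb{F}$ be a field and let $X,Y$ be simplicial complexes on the same finite vertex set $V$. Then $$L_Y(X;\mathbb{F}) = \min\{d : \tilde H_i(\mathrm{lk}(X,\sigma);\mathbb{F})=0 \text{ for all } i \geq d \text{ and all } \sigma \in Y\}.$$
   Context: $\tilde H_i(\cdot;\mathbb{F})$ denotes reduced simplicial homology with coefficients in $\mathbb{F}$ (so the complex $\{\emptyset\}$ has $\tilde H_{ -1}=\mathbb{F}$, and the void complex $\{\,\}$ has all reduced homology zero). For $S\subset V$, $X[S]=\{\tau\in X:\tau\subset S\}$. For $\tau \subset V$, $\mathrm{st}(X,\tau)=\{\sigma\in X : \sigma\cup\tau\in X\}$ and $\mathrm{lk}(X,\tau)=\{\sigma \in \mathrm{st}(X,\tau): \sigma\cap\tau=\emptyset\}$; if $\tau\notin X$ these are the void complex. The relative Leray number is $L_Y(X;\mathbb{F})=\min\{d : \tilde H_i(X[V\setminus \sigma];\mathbb{F})=0 \text{ for all } i \geq d \text{ and all } \sigma \in Y\}$. -}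

module Defs where

open import Level using (Level; _⊔_)
open import Data.Nat as ℕ using (ℕ; zero; suc; _<ᵇ_)
open import Data.Bool using (Bool; true; false; if_then_else_; _∧_)
open import Data.Fin as Fin using (Fin; toℕ)
open import Data.Fin.Subset using (Subset; _∈_; _∉_; _⊆_; _∪_; _∩_; ⁅_⁆; ∣_∣; ∁; Empty)
open import Data.Vec using (lookup)
open import Data.Product using (Σ; _×_; ∃)
open import Relation.Nullary using (¬_)
open import Relation.Binary.PropositionalEquality using (_≡_)
open import Algebra.Bundles using (CommutativeRing)
open import Data.Integer as ℤ using (ℤ; +_)

record Field (c ℓ : Level) : Set (Level.suc (c ⊔ ℓ)) where
  field
    commutativeRing : CommutativeRing c ℓ
  open CommutativeRing commutativeRing public
  field
    0≉1     : ¬ (0# ≈ 1#)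
    inverse : ∀ x → ¬ (x ≈ 0#) → Σ Carrier (λ y → x * y ≈ 1#)

-- The void complex (no faces) is allowed, and
-- {∅} is the complex whose only face is ∅.

record SimplicialComplex (n : ℕ) : Set₁ where
  field
    Face     : Subset n → Set
    downward : ∀ {σ τ} → τ ⊆ σ → Face σ → Face τ
open SimplicialComplex public

induced : ∀ {n} → SimplicialComplex n → Subset n → SimplicialComplex n
induced X S = record
  { Face     = λ τ → Face X τ × τ ⊆ S
  ; downward = λ τ⊆σ (f , σ⊆S) → downward X τ⊆σ f , (λ x → σ⊆S (τ⊆σ x)) }
  where open Data.Product using (_,_)

Disjoint : ∀ {n} → Subset n → Subset n → Set
Disjoint σ τ = Empty (σ ∩ τ)

-- link lk(X,τ) = {σ : σ ∪ τ ∈ X, σ ∩ τ = ∅}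
-- (this is automatically the void complex when τ ∉ X)
link : ∀ {n} → SimplicialComplex n → Subset n → SimplicialComplex n
link {n} X τ = record
  { Face     = λ σ → Face X (σ ∪ τ) × Disjoint σ τ
  ; downward = dw }
  where
  open Data.Product using (_,_; proj₁; proj₂)
  open import Data.Fin.Subset.Properties using (x∈p∪q⁻; x∈p∪q⁺; x∈p∩q⁻; x∈p∩q⁺)
  open import Data.Sum using (inj₁; inj₂)
  dw : ∀ {σ ρ} → ρ ⊆ σ → Face X (σ ∪ τ) × Disjoint σ τ → Face X (ρ ∪ τ) × Disjoint ρ τ
  dw {σ} {ρ} ρ⊆σ (f , d) = downward X sub f , disj
    where
    sub : (ρ ∪ τ) ⊆ (σ ∪ τ)
    sub {x} x∈ with x∈p∪q⁻ ρ τ x∈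
    ... | inj₁ a = x∈p∪q⁺ (inj₁ (ρ⊆σ a))
    ... | inj₂ b = x∈p∪q⁺ (inj₂ b)
    disj : Disjoint ρ τ
    disj (x , x∈) with x∈p∩q⁻ ρ τ x∈
    ... | a , b = d (x , x∈p∩q⁺ (ρ⊆σ a , b))

-- A chain is a function c : Subset n → F; it is a k-chain of X
-- (k = number of vertices = dimension + 1) if it vanishes off the
-- faces of X with exactly k vertices.  C_{-1} corresponds to k = 0,
-- spanned by the empty face (reduced/augmented complex).

module Chains {c ℓ} (F : Field c ℓ) {n : ℕ} where
  open Field F using (Carrier; _≈_; _+_; _*_; -_; 0#; 1#)

  sumFin : ∀ {m} → (Fin m → Carrier) → Carrier
  sumFin {zero}  f = 0#
  sumFin {suc m} f = f Fin.zero + sumFin (λ i → f (Fin.suc i))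

  sign : ℕ → Carrier
  sign zero    = 1#
  sign (suc k) = - sign k

  below : Subset n → Fin n → ℕ
  below τ v = count (λ u → lookup τ u ∧ (toℕ u <ᵇ toℕ v))
    where
    count : ∀ {m} → (Fin m → Bool) → ℕ
    count {zero}  p = 0
    count {suc m} p = (if p Fin.zero then 1 else 0) ℕ.+ count (λ i → p (Fin.suc i))

  IsChain : SimplicialComplex n → ℕ → (Subset n → Carrier) → Set ℓ
  IsChain X k ch = ∀ σ → ¬ (Face X σ × ∣ σ ∣ ≡ k) → ch σ ≈ 0#

  -- boundary: ∂[v₀,…,v_k] = Σ_j (-1)^j [v₀,…,v̂_j,…,v_k]; the
  -- coefficient of τ in ∂(τ ∪ {v}) (v ∉ τ) is (-1)^{#{u ∈ τ : u < v}}.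
  ∂ : (Subset n → Carrier) → (Subset n → Carrier)
  ∂ ch τ = sumFin (λ v → if lookup τ v then 0#
                         else sign (below τ v) * ch (τ ∪ ⁅ v ⁆))

  -- H̃_{k-1}(X;F) = 0 : every (k)-vertex cycle is a boundary
  ReducedHomologyVanishes : SimplicialComplex n → ℕ → Set (c ⊔ ℓ)
  ReducedHomologyVanishes X k =
    ∀ z → IsChain X k z → (∀ τ → ∂ z τ ≈ 0#) →
    ∃ λ b → IsChain X (suc k) b × (∀ σ → ∂ b σ ≈ z σ)

  -- "H̃_i(X;F) = 0 for all i ≥ d"   (d ∈ ℤ; i = k - 1 with k ∈ ℕ, since
  --  H̃_i = 0 trivially for i < -1)
  VanishesFrom : SimplicialComplex n → ℤ → Set (c ⊔ ℓ)
  VanishesFrom X d = ∀ k → d ℤ.≤ (+ k ℤ.- ℤ.1ℤ) → ReducedHomologyVanishes X k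

  -- d belongs to the set whose minimum is the relative Leray number L_Y(X;F)
  LerayBound : SimplicialComplex n → SimplicialComplex n → ℤ → Set (c ⊔ ℓ)
  LerayBound Y X d = ∀ σ → Face Y σ → VanishesFrom (induced X (∁ σ)) d

  -- d belongs to the set on the right-hand side (links)
  LinkBound : SimplicialComplex n → SimplicialComplex n → ℤ → Set (c ⊔ ℓ)
  LinkBound Y X d = ∀ σ → Face Y σ → VanishesFrom (link X σ) d

-- For σ ∪ τ ∈ Y with σ ∩ τ = ∅ consider the relative link lk(X[V ∖ τ], σ): for σ = ∅ it is
-- X[V ∖ τ], for τ = ∅ it is lk(X, σ).  Moving one vertex v from σ to τ (or back) relates a
-- relative link K to K ∖ v and to lk(K, v), and the long exact sequence of the pair (K, K ∖ v),
-- whose relative homology is that of lk(K, v) shifted by one, shows: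
--   H̃_{≥d}(K) = H̃_{≥d}(K ∖ v) = 0  ⇒  H̃_{≥d}(lk(K, v)) = 0,
--   H̃_{≥d}(lk(K, v)) = H̃_{≥d}(K) = 0  ⇒  H̃_{≥d}(K ∖ v) = 0.
-- Induction on |σ| (resp. |τ|) carries vanishing from one side of the equivalence to the other.
-- The two implications are proved on chains: ∂ is the sum over vertices v of the contraction
-- with v, which anticommutes with ∂, and coning off with apex v is a section of it.

module Submission where

open import Defs
open import Data.Nat using (ℕ)
open import Data.Integer using (ℤ)
open import Data.Product using (_×_)
open import Algebra.Bundles using (Ring)

open import Data.Bool using (true; false; if_then_else_; T)
open import Data.Empty using (⊥-elim)
open import Data.Fin using (Fin; zero; suc; toℕ; _≟_)
open import Data.Fin.Properties using (toℕ-injective; punchInᵢ≢i)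
open import Data.Fin.Subset using (Subset; ⊥; _∈_; _∉_; _⊆_; _∪_; _-_; ⁅_⁆; ∁; ∣_∣; outside; inside)
open import Data.Fin.Subset.Properties
open import Data.Nat as ℕ using (_<ᵇ_)
import Data.Integer as ℤ
import Data.Integer.Properties as ℤ
import Data.Nat.Properties as ℕ
open import Data.Product using (_,_; proj₁)
open import Data.Sum using (_⊎_; inj₁; inj₂)
open import Data.Vec using ([]; _∷_; lookup; here; there)
open import Data.Vec.Properties using ([]=⇒lookup; lookup⇒[]=)
open import Relation.Nullary using (¬_; yes; no)
open import Relation.Binary using (tri<; tri≈; tri>)
open import Function using (_∘_; case_of_)
open import Relation.Binary.PropositionalEquality
  using (_≡_; _≢_; refl; sym; trans; cong; subst; module ≡-Reasoning)

private variable n : ℕ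

∉⇒lookup≡false : ∀ {x : Fin n} {p} → x ∉ p → lookup p x ≡ false
∉⇒lookup≡false {x = x} {p} x∉p with lookup p x in eq
... | true  = ⊥-elim (x∉p (lookup⇒[]= x p eq))
... | false = refl

x∈p∪⁅x⁆ : ∀ (p : Subset n) x → x ∈ p ∪ ⁅ x ⁆
x∈p∪⁅x⁆ p x = x∈p∪q⁺ (inj₂ (x∈⁅x⁆ x))

x∉p-x : ∀ (p : Subset n) x → x ∉ p - x
x∉p-x (_ ∷ p) zero    ()
x∉p-x (_ ∷ p) (suc x) (there x∈p-x) = x∉p-x p x x∈p-x

p∪⁅x⁆-x≡p : ∀ {p : Subset n} {x} → x ∉ p → (p ∪ ⁅ x ⁆) - x ≡ p
p∪⁅x⁆-x≡p {p = p} {x} x∉p = ⊆-antisym ⊆p ⊇p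
  where
  ⊆p : (p ∪ ⁅ x ⁆) - x ⊆ p
  ⊆p {y} y∈ with x∈p∪q⁻ p ⁅ x ⁆ (p─q⊆p _ _ y∈)
  ... | inj₁ y∈p = y∈p
  ... | inj₂ y∈x = ⊥-elim (x∉p-x (p ∪ ⁅ x ⁆) x (subst (_∈ _) (x∈⁅y⁆⇒x≡y x y∈x) y∈))
  ⊇p : p ⊆ (p ∪ ⁅ x ⁆) - x
  ⊇p {y} y∈p = x∈p∧x≢y⇒x∈p-y (p⊆p∪q ⁅ x ⁆ y∈p) λ { refl → x∉p y∈p }

p-x∪⁅x⁆≡p : ∀ {p : Subset n} {x} → x ∈ p → (p - x) ∪ ⁅ x ⁆ ≡ p
p-x∪⁅x⁆≡p {p = p} {x} x∈p = ⊆-antisym ⊆p ⊇p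
  where
  ⊆p : (p - x) ∪ ⁅ x ⁆ ⊆ p
  ⊆p {y} y∈ with x∈p∪q⁻ (p - x) ⁅ x ⁆ y∈
  ... | inj₁ y∈p-x = p─q⊆p p ⁅ x ⁆ y∈p-x
  ... | inj₂ y∈x   = subst (_∈ p) (sym (x∈⁅y⁆⇒x≡y x y∈x)) x∈p
  ⊇p : p ⊆ (p - x) ∪ ⁅ x ⁆
  ⊇p {y} y∈p with y ≟ x
  ... | yes refl = x∈p∪⁅x⁆ (p - x) x
  ... | no  y≢x  = p⊆p∪q ⁅ x ⁆ (x∈p∧x≢y⇒x∈p-y y∈p y≢x)

∪-swapʳ : ∀ (p q r : Subset n) → (p ∪ q) ∪ r ≡ (p ∪ r) ∪ q
∪-swapʳ p q r = begin
  (p ∪ q) ∪ r ≡⟨ ∪-assoc p q r ⟩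
  p ∪ (q ∪ r) ≡⟨ cong (p ∪_) (∪-comm q r) ⟩
  p ∪ (r ∪ q) ≡⟨ ∪-assoc p r q ⟨
  (p ∪ r) ∪ q ∎
  where open ≡-Reasoning

x∉p∪⁅y⁆ : ∀ {p : Subset n} {x y} → x ∉ p → x ≢ y → x ∉ p ∪ ⁅ y ⁆
x∉p∪⁅y⁆ {p = p} {x} {y} x∉p x≢y x∈ with x∈p∪q⁻ p ⁅ y ⁆ x∈
... | inj₁ x∈p = x∉p x∈p
... | inj₂ x∈y = x≢y (x∈⁅y⁆⇒x≡y y x∈y)

Disjoint⁺ : ∀ {p q : Subset n} → (∀ {x} → x ∈ p → x ∉ q) → Disjoint p q
Disjoint⁺ {p = p} {q} disjoint (x , x∈p∩q) = let x∈p , x∈q = x∈p∩q⁻ p q x∈p∩q in disjoint x∈p x∈q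

Disjoint⁻ : ∀ {p q : Subset n} {x} → Disjoint p q → x ∈ p → x ∉ q
Disjoint⁻ {x = x} disjoint x∈p x∈q = disjoint (x , x∈p∩q⁺ (x∈p , x∈q))

∉⇒Disjoint⁅⁆ : ∀ {p : Subset n} {x} → x ∉ p → Disjoint p ⁅ x ⁆
∉⇒Disjoint⁅⁆ {p = p} {x} x∉p = Disjoint⁺ λ y∈p y∈x → x∉p (subst (_∈ p) (x∈⁅y⁆⇒x≡y x y∈x) y∈p)

Disjoint⁅⁆⇒∉ : ∀ {p : Subset n} {x} → Disjoint p ⁅ x ⁆ → x ∉ p
Disjoint⁅⁆⇒∉ {x = x} disjoint x∈p = Disjoint⁻ disjoint x∈p (x∈⁅x⁆ x)

∉⇒⊆∁⁅⁆ : ∀ {p : Subset n} {x} → x ∉ p → p ⊆ ∁ ⁅ x ⁆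
∉⇒⊆∁⁅⁆ {p = p} {x} x∉p y∈p = x∉p⇒x∈∁p (λ y∈x → x∉p (subst (_∈ p) (x∈⁅y⁆⇒x≡y x y∈x) y∈p))

⊆∁⁅⁆⇒∉ : ∀ {p : Subset n} {x} → p ⊆ ∁ ⁅ x ⁆ → x ∉ p
⊆∁⁅⁆⇒∉ {x = x} p⊆ x∈p = x∈∁p⇒x∉p (p⊆ x∈p) (x∈⁅x⁆ x)

∪⊆ : ∀ {p q r : Subset n} → p ⊆ r → q ⊆ r → p ∪ q ⊆ r
∪⊆ {p = p} {q} p⊆r q⊆r x∈p∪q with x∈p∪q⁻ p q x∈p∪q
... | inj₁ x∈p = p⊆r x∈p
... | inj₂ x∈q = q⊆r x∈q

⊆∁∪ : ∀ {p q r : Subset n} → p ⊆ ∁ q → p ⊆ ∁ r → p ⊆ ∁ (q ∪ r)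
⊆∁∪ {q = q} {r} p⊆∁q p⊆∁r x∈p = x∉p⇒x∈∁p λ x∈q∪r → case x∈p∪q⁻ q r x∈q∪r of λ where
  (inj₁ x∈q) → x∈∁p⇒x∉p (p⊆∁q x∈p) x∈q
  (inj₂ x∈r) → x∈∁p⇒x∉p (p⊆∁r x∈p) x∈r

∣p∪⁅x⁆∣≡1+∣p∣ : ∀ {p : Subset n} {x} → x ∉ p → ∣ p ∪ ⁅ x ⁆ ∣ ≡ ℕ.suc ∣ p ∣
∣p∪⁅x⁆∣≡1+∣p∣ {p = inside  ∷ p} {zero}  x∉p = ⊥-elim (x∉p here)
∣p∪⁅x⁆∣≡1+∣p∣ {p = outside ∷ p} {zero}  x∉p = cong (λ q → ℕ.suc ∣ q ∣) (∪-identityʳ p)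
∣p∪⁅x⁆∣≡1+∣p∣ {p = inside  ∷ p} {suc x} x∉p = cong ℕ.suc (∣p∪⁅x⁆∣≡1+∣p∣ (λ x∈p → x∉p (there x∈p)))
∣p∪⁅x⁆∣≡1+∣p∣ {p = outside ∷ p} {suc x} x∉p = ∣p∪⁅x⁆∣≡1+∣p∣ (λ x∈p → x∉p (there x∈p))

∣p∣≡1+∣p-x∣ : ∀ {p : Subset n} {x} → x ∈ p → ∣ p ∣ ≡ ℕ.suc ∣ p - x ∣
∣p∣≡1+∣p-x∣ {p = p} {x} x∈p = trans (cong ∣_∣ (sym (p-x∪⁅x⁆≡p x∈p))) (∣p∪⁅x⁆∣≡1+∣p∣ (x∉p-x p x))

[_<_] : Fin n → Fin n → ℕ
[ u < v ] = if toℕ u <ᵇ toℕ v then 1 else 0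

[<]≡1 : ∀ {u v : Fin n} → toℕ u ℕ.< toℕ v → [ u < v ] ≡ 1
[<]≡1 {u = u} {v} u<v with toℕ u <ᵇ toℕ v | ℕ.<⇒<ᵇ u<v
... | true | _ = refl

[<]≡0 : ∀ {u v : Fin n} → toℕ v ℕ.≤ toℕ u → [ u < v ] ≡ 0
[<]≡0 {u = u} {v} v≤u with toℕ u <ᵇ toℕ v in eq
... | true  = ⊥-elim (ℕ.<⇒≱ (ℕ.<ᵇ⇒< (toℕ u) (toℕ v) (subst T (sym eq) _)) v≤u)
... | false = refl

[<]-antisym : ∀ {u v : Fin n} → u ≢ v →
              ([ u < v ] ≡ 1 × [ v < u ] ≡ 0) ⊎ ([ u < v ] ≡ 0 × [ v < u ] ≡ 1)
[<]-antisym {u = u} {v} u≢v with ℕ.<-cmp (toℕ u) (toℕ v)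
... | tri< u<v _ _ = inj₁ ([<]≡1 u<v , [<]≡0 (ℕ.<⇒≤ u<v))
... | tri≈ _ u≡v _ = ⊥-elim (u≢v (toℕ-injective u≡v))
... | tri> _ _ v<u = inj₂ ([<]≡0 (ℕ.<⇒≤ v<u) , [<]≡1 v<u)

module RingSums {c ℓ} (R : Ring c ℓ) where
  open Ring R hiding (zero) renaming (refl to ≈-refl; sym to ≈-sym; trans to ≈-trans)
  open import Algebra.Properties.Ring R using (-0#≈0#; -1*x≈-x)
  open import Algebra.Properties.Semiring.Sum semiring
    using (sum; sum-cong-≋; sum-remove; ∑-distrib-+; *-distribˡ-sum; sum-replicate-zero)
  open import Data.Vec.Functional using (removeAt)
  open import Relation.Binary.Reasoning.Setoid setoid

  -≈0 : ∀ {x} → x ≈ 0# → - x ≈ 0#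
  -≈0 x≈0 = ≈-trans (-‿cong x≈0) -0#≈0#

  sum-zero : ∀ {m} {f : Fin m → Carrier} → (∀ i → f i ≈ 0#) → sum f ≈ 0#
  sum-zero {m} f≈0 = ≈-trans (sum-cong-≋ f≈0) (sum-replicate-zero m)

  sum-neg : ∀ {m} (f : Fin m → Carrier) → sum (λ i → - f i) ≈ - sum f
  sum-neg f = begin
    sum (λ i → - f i)       ≈⟨ sum-cong-≋ (λ i → -1*x≈-x (f i)) ⟨
    sum (λ i → - 1# * f i)  ≈⟨ *-distribˡ-sum (- 1#) f ⟨
    - 1# * sum f            ≈⟨ -1*x≈-x _ ⟩
    - sum f                 ∎

  sum-single : ∀ {m} (f : Fin m → Carrier) i → (∀ j → j ≢ i → f j ≈ 0#) → sum f ≈ f i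
  sum-single {ℕ.suc m} f i f≈0 = begin
    sum f                       ≈⟨ sum-remove f ⟩
    f i + sum (removeAt f i)    ≈⟨ +-congˡ (sum-zero (λ j → f≈0 _ (punchInᵢ≢i i j))) ⟩
    f i + 0#                    ≈⟨ +-identityʳ _ ⟩
    f i                         ∎

  -- In characteristic 2 antisymmetry does not force the diagonal to vanish.
  sum²-antisym≈0 : ∀ {m} (f : Fin m → Fin m → Carrier) →
                   (∀ i j → f i j ≈ - f j i) → (∀ i → f i i ≈ 0#) → sum (λ i → sum (f i)) ≈ 0#
  sum²-antisym≈0 {ℕ.zero}  f anti diag = ≈-refl
  sum²-antisym≈0 {ℕ.suc m} f anti diag = begin
    (f zero zero + A) + sum (λ i → f (suc i) zero + sum (λ j → f (suc i) (suc j)))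
      ≈⟨ +-cong (+-congʳ (diag zero)) (∑-distrib-+ (λ i → f (suc i) zero) _) ⟩
    (0# + A) + (sum (λ i → f (suc i) zero) + sum (λ i → sum (λ j → f (suc i) (suc j))))
      ≈⟨ +-cong (+-identityˡ A) (+-cong column rest≈0) ⟩
    A + (- A + 0#)  ≈⟨ +-congˡ (+-identityʳ _) ⟩
    A + - A         ≈⟨ -‿inverseʳ A ⟩
    0#              ∎
    where
    A = sum (λ j → f zero (suc j))
    column : sum (λ i → f (suc i) zero) ≈ - A
    column = ≈-trans (sum-cong-≋ (λ i → anti (suc i) zero)) (sum-neg (λ j → f zero (suc j)))
    rest≈0 : sum (λ i → sum (λ j → f (suc i) (suc j))) ≈ 0#
    rest≈0 = sum²-antisym≈0 (λ i j → f (suc i) (suc j)) (λ i j → anti (suc i) (suc j)) (λ i → diag (suc i))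

-- Simplicial chains: contraction and cone

module Boundary {c ℓ} (F : Field c ℓ) where
  open Field F hiding (_-_; zero) renaming (refl to ≈-refl; sym to ≈-sym; trans to ≈-trans)
  open import Algebra.Properties.Ring ring using (-‿distribˡ-*; -‿distribʳ-*; -0#≈0#; -‿involutive)
  open import Algebra.Properties.Semiring.Sum semiring using (sum; sum-cong-≋; ∑-distrib-+; *-distribˡ-sum)
  open import Relation.Binary.Reasoning.Setoid setoid
  open RingSums ring using (-≈0; sum-zero; sum-neg; sum-single; sum²-antisym≈0)
  open import Algebra.Properties.CommutativeSemigroup *-commutativeSemigroup using (x∙yz≈y∙xz)
  open Chains F using (below)

  below-zero : ∀ (τ : Subset (ℕ.suc n)) → below τ zero ≡ 0
  below-zero {ℕ.zero} (outside ∷ []) = refl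
  below-zero {ℕ.zero} (inside  ∷ []) = refl
  below-zero {ℕ.suc n} (outside ∷ τ) = below-zero τ
  below-zero {ℕ.suc n} (inside  ∷ τ) = below-zero τ

  below-∪⁅⁆ : ∀ {τ : Subset n} {v} u → v ∉ τ → below (τ ∪ ⁅ v ⁆) u ≡ below τ u ℕ.+ [ v < u ]
  below-∪⁅⁆ {τ = τ} {v} zero v∉τ rewrite below-zero (τ ∪ ⁅ v ⁆) | below-zero τ = refl
  below-∪⁅⁆ {τ = inside ∷ τ} {zero} (suc u) v∉τ = ⊥-elim (v∉τ here)
  below-∪⁅⁆ {τ = outside ∷ τ} {zero} (suc u) v∉τ rewrite ∪-identityʳ τ = ℕ.+-comm 1 (below τ u)
  below-∪⁅⁆ {τ = inside ∷ τ} {suc v} (suc u) v∉τ = cong ℕ.suc (below-∪⁅⁆ u (λ v∈τ → v∉τ (there v∈τ)))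
  below-∪⁅⁆ {τ = outside ∷ τ} {suc v} (suc u) v∉τ = below-∪⁅⁆ u (λ v∈τ → v∉τ (there v∈τ))

  module _ {n : ℕ} where
    open Chains F {n} hiding (below)

    sign-+ : ∀ m k → sign (m ℕ.+ k) ≈ sign m * sign k
    sign-+ ℕ.zero    k = ≈-sym (*-identityˡ _)
    sign-+ (ℕ.suc m) k = begin
      - sign (m ℕ.+ k)     ≈⟨ -‿cong (sign-+ m k) ⟩
      - (sign m * sign k)  ≈⟨ -‿distribˡ-* _ _ ⟩
      - sign m * sign k    ∎

    sign²≈1 : ∀ m → sign m * sign m ≈ 1#
    sign²≈1 ℕ.zero    = *-identityˡ 1#
    sign²≈1 (ℕ.suc m) = begin
      - sign m * - sign m      ≈⟨ -‿distribˡ-* _ _ ⟨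
      - (sign m * - sign m)    ≈⟨ -‿cong (-‿distribʳ-* _ _) ⟨
      - - (sign m * sign m)    ≈⟨ -‿involutive _ ⟩
      sign m * sign m          ≈⟨ sign²≈1 m ⟩
      1#                       ∎

    sign-[<]-antisym : ∀ {u v : Fin n} → u ≢ v → sign [ u < v ] ≈ - sign [ v < u ]
    sign-[<]-antisym u≢v with [<]-antisym u≢v
    ... | inj₁ (u<v , v≮u) rewrite u<v | v≮u = ≈-refl
    ... | inj₂ (u≮v , v<u) rewrite u≮v | v<u = ≈-sym (-‿involutive 1#)

    sumFin≡sum : ∀ {m} (f : Fin m → Carrier) → sumFin f ≡ sum f
    sumFin≡sum {ℕ.zero}  f = refl
    sumFin≡sum {ℕ.suc m} f = cong (f zero +_) (sumFin≡sum (λ i → f (suc i)))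

    Chain : Set c
    Chain = Subset n → Carrier

    𝟘 : Chain
    𝟘 _ = 0#

    infix 4 _≋_
    _≋_ : Chain → Chain → Set ℓ
    a ≋ b = ∀ σ → a σ ≈ b σ

    infixl 6 _⊕_
    _⊕_ : Chain → Chain → Chain
    (a ⊕ b) σ = a σ + b σ

    ⊖_ : Chain → Chain
    (⊖ a) σ = - a σ

    sgn : Subset n → Fin n → Carrier
    sgn τ v = sign (below τ v)

    sgn-involutive : ∀ τ v x → sgn τ v * (sgn τ v * x) ≈ x
    sgn-involutive τ v x = begin
      sgn τ v * (sgn τ v * x)  ≈⟨ *-assoc _ _ _ ⟨
      (sgn τ v * sgn τ v) * x  ≈⟨ *-congʳ (sign²≈1 (below τ v)) ⟩
      1# * x                   ≈⟨ *-identityˡ x ⟩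
      x                        ∎

    sgn-swap : ∀ {τ u v} → u ∉ τ → v ∉ τ → u ≢ v →
               sgn τ v * sgn (τ ∪ ⁅ v ⁆) u ≈ - (sgn τ u * sgn (τ ∪ ⁅ u ⁆) v)
    sgn-swap {τ} {u} {v} u∉τ v∉τ u≢v = begin
      sgn τ v * sgn (τ ∪ ⁅ v ⁆) u                ≡⟨ cong (λ k → sign bv * sign k) (below-∪⁅⁆ u v∉τ) ⟩
      sign bv * sign (bu ℕ.+ [ v < u ])          ≈⟨ *-congˡ (sign-+ bu _) ⟩
      sign bv * (sign bu * sign [ v < u ])       ≈⟨ *-congˡ (*-congˡ (sign-[<]-antisym (u≢v ∘ sym))) ⟩
      sign bv * (sign bu * - sign [ u < v ])     ≈⟨ *-congˡ (-‿distribʳ-* _ _) ⟨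
      sign bv * - (sign bu * sign [ u < v ])     ≈⟨ -‿distribʳ-* _ _ ⟨
      - (sign bv * (sign bu * sign [ u < v ]))   ≈⟨ -‿cong (x∙yz≈y∙xz _ _ _) ⟩
      - (sign bu * (sign bv * sign [ u < v ]))   ≈⟨ -‿cong (*-congˡ (sign-+ bv _)) ⟨
      - (sign bu * sign (bv ℕ.+ [ u < v ]))      ≡⟨ cong (λ k → - (sign bu * sign k)) (below-∪⁅⁆ v u∉τ) ⟨
      - (sgn τ u * sgn (τ ∪ ⁅ u ⁆) v)            ∎
      where
      bu = below τ u
      bv = below τ v

    contract : Fin n → Chain → Chain
    contract v a τ = if lookup τ v then 0# else sgn τ v * a (τ ∪ ⁅ v ⁆)

    cone : Fin n → Chain → Chain
    cone v a ρ = if lookup ρ v then sgn (ρ - v) v * a (ρ - v) else 0#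

    Avoids : Fin n → Chain → Set ℓ
    Avoids v a = ∀ ρ → v ∈ ρ → a ρ ≈ 0#

    ∂≈sum-contract : ∀ a τ → ∂ a τ ≈ sum (λ v → contract v a τ)
    ∂≈sum-contract a τ = reflexive (sumFin≡sum (λ v → contract v a τ))

    contract-∈ : ∀ {v τ} a → v ∈ τ → contract v a τ ≡ 0#
    contract-∈ a v∈τ rewrite []=⇒lookup v∈τ = refl

    contract-∉ : ∀ {v τ} a → v ∉ τ → contract v a τ ≡ sgn τ v * a (τ ∪ ⁅ v ⁆)
    contract-∉ a v∉τ rewrite ∉⇒lookup≡false v∉τ = refl

    cone-∈ : ∀ {v ρ} a → v ∈ ρ → cone v a ρ ≡ sgn (ρ - v) v * a (ρ - v)
    cone-∈ a v∈ρ rewrite []=⇒lookup v∈ρ = refl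

    cone-∉ : ∀ {v ρ} a → v ∉ ρ → cone v a ρ ≡ 0#
    cone-∉ a v∉ρ rewrite ∉⇒lookup≡false v∉ρ = refl

    contract-cong : ∀ v {a b} → a ≋ b → contract v a ≋ contract v b
    contract-cong v a≋b τ with lookup τ v
    ... | true  = ≈-refl
    ... | false = *-congˡ (a≋b _)

    contract-⊕ : ∀ v a b → contract v (a ⊕ b) ≋ contract v a ⊕ contract v b
    contract-⊕ v a b τ with lookup τ v
    ... | true  = ≈-sym (+-identityʳ 0#)
    ... | false = distribˡ _ _ _

    contract-⊖ : ∀ v a → contract v (⊖ a) ≋ ⊖ contract v a
    contract-⊖ v a τ with lookup τ v
    ... | true  = ≈-sym -0#≈0#
    ... | false = ≈-sym (-‿distribʳ-* _ _)

    ∂-cong : ∀ {a b} → a ≋ b → ∂ a ≋ ∂ b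
    ∂-cong {a} {b} a≋b τ = begin
      ∂ a τ                         ≈⟨ ∂≈sum-contract a τ ⟩
      sum (λ v → contract v a τ)    ≈⟨ sum-cong-≋ (λ v → contract-cong v a≋b τ) ⟩
      sum (λ v → contract v b τ)    ≈⟨ ∂≈sum-contract b τ ⟨
      ∂ b τ                         ∎

    ∂-⊕ : ∀ a b → ∂ (a ⊕ b) ≋ ∂ a ⊕ ∂ b
    ∂-⊕ a b τ = begin
      ∂ (a ⊕ b) τ                                     ≈⟨ ∂≈sum-contract (a ⊕ b) τ ⟩
      sum (λ v → contract v (a ⊕ b) τ)                ≈⟨ sum-cong-≋ (λ v → contract-⊕ v a b τ) ⟩
      sum (λ v → contract v a τ + contract v b τ)     ≈⟨ ∑-distrib-+ (λ v → contract v a τ) (λ v → contract v b τ) ⟩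
      sum (λ v → contract v a τ) + sum (λ v → contract v b τ)
        ≈⟨ +-cong (∂≈sum-contract a τ) (∂≈sum-contract b τ) ⟨
      ∂ a τ + ∂ b τ                                   ∎

    ∂-⊖ : ∀ a → ∂ (⊖ a) ≋ ⊖ ∂ a
    ∂-⊖ a τ = begin
      ∂ (⊖ a) τ                          ≈⟨ ∂≈sum-contract (⊖ a) τ ⟩
      sum (λ v → contract v (⊖ a) τ)     ≈⟨ sum-cong-≋ (λ v → contract-⊖ v a τ) ⟩
      sum (λ v → - contract v a τ)       ≈⟨ sum-neg (λ v → contract v a τ) ⟩
      - sum (λ v → contract v a τ)       ≈⟨ -‿cong (∂≈sum-contract a τ) ⟨
      - ∂ a τ                            ∎

    contract²≈0 : ∀ {u v τ} a → v ∈ τ ∪ ⁅ u ⁆ → contract u (contract v a) τ ≈ 0#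
    contract²≈0 {u} {v} {τ} a v∈ with lookup τ u
    ... | true  = ≈-refl
    ... | false = ≈-trans (*-congˡ (reflexive (contract-∈ a v∈))) (zeroʳ _)

    contract-anticomm : ∀ u v a → contract v (contract u a) ≋ ⊖ contract u (contract v a)
    contract-anticomm u v a τ with u ≟ v | u ∈? τ | v ∈? τ
    ... | yes refl | _ | _ = ≈-trans (contract²≈0 a (x∈p∪⁅x⁆ τ u)) (≈-sym (-≈0 (contract²≈0 a (x∈p∪⁅x⁆ τ u))))
    ... | no _ | _ | yes v∈τ = ≈-trans (reflexive (contract-∈ (contract u a) v∈τ))
                                      (≈-sym (-≈0 (contract²≈0 a (p⊆p∪q ⁅ u ⁆ v∈τ))))
    ... | no _ | yes u∈τ | no _ = ≈-trans (contract²≈0 a (p⊆p∪q ⁅ v ⁆ u∈τ))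
                                         (≈-sym (-≈0 (reflexive (contract-∈ (contract v a) u∈τ))))
    ... | no u≢v | no u∉τ | no v∉τ = begin
      contract v (contract u a) τ
        ≡⟨ contract-∉ (contract u a) v∉τ ⟩
      sgn τ v * contract u a (τ ∪ ⁅ v ⁆)
        ≡⟨ cong (sgn τ v *_) (contract-∉ a (x∉p∪⁅y⁆ u∉τ u≢v)) ⟩
      sgn τ v * (sgn (τ ∪ ⁅ v ⁆) u * a ((τ ∪ ⁅ v ⁆) ∪ ⁅ u ⁆))
        ≈⟨ *-assoc _ _ _ ⟨
      (sgn τ v * sgn (τ ∪ ⁅ v ⁆) u) * a ((τ ∪ ⁅ v ⁆) ∪ ⁅ u ⁆)
        ≈⟨ *-cong (sgn-swap u∉τ v∉τ u≢v) (reflexive (cong a (∪-swapʳ τ ⁅ v ⁆ ⁅ u ⁆))) ⟩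
      - (sgn τ u * sgn (τ ∪ ⁅ u ⁆) v) * a ((τ ∪ ⁅ u ⁆) ∪ ⁅ v ⁆)
        ≈⟨ -‿distribˡ-* _ _ ⟨
      - ((sgn τ u * sgn (τ ∪ ⁅ u ⁆) v) * a ((τ ∪ ⁅ u ⁆) ∪ ⁅ v ⁆))
        ≈⟨ -‿cong (*-assoc _ _ _) ⟩
      - (sgn τ u * (sgn (τ ∪ ⁅ u ⁆) v * a ((τ ∪ ⁅ u ⁆) ∪ ⁅ v ⁆)))
        ≡⟨ cong (λ x → - (sgn τ u * x)) (contract-∉ a (x∉p∪⁅y⁆ v∉τ (u≢v ∘ sym))) ⟨
      - (sgn τ u * contract v a (τ ∪ ⁅ u ⁆))
        ≡⟨ cong -_ (contract-∉ (contract v a) u∉τ) ⟨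
      - contract u (contract v a) τ
        ∎

    contract-∂≈sum : ∀ v a τ → contract v (∂ a) τ ≈ sum (λ u → contract v (contract u a) τ)
    contract-∂≈sum v a τ with lookup τ v
    ... | true  = ≈-sym (sum-zero {m = n} (λ _ → ≈-refl))
    ... | false = ≈-trans (*-congˡ (∂≈sum-contract a (τ ∪ ⁅ v ⁆)))
                          (*-distribˡ-sum (sgn τ v) (λ u → contract u a (τ ∪ ⁅ v ⁆)))

    contract-∂ : ∀ v a → contract v (∂ a) ≋ ⊖ ∂ (contract v a)
    contract-∂ v a τ = begin
      contract v (∂ a) τ                          ≈⟨ contract-∂≈sum v a τ ⟩
      sum (λ u → contract v (contract u a) τ)     ≈⟨ sum-cong-≋ (λ u → contract-anticomm u v a τ) ⟩
      sum (λ u → - contract u (contract v a) τ)   ≈⟨ sum-neg (λ u → contract u (contract v a) τ) ⟩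
      - sum (λ u → contract u (contract v a) τ)   ≈⟨ -‿cong (∂≈sum-contract (contract v a) τ) ⟨
      - ∂ (contract v a) τ                        ∎

    ∂∘∂≋𝟘 : ∀ a → ∂ (∂ a) ≋ 𝟘
    ∂∘∂≋𝟘 a τ = begin
      ∂ (∂ a) τ                                                 ≈⟨ ∂≈sum-contract (∂ a) τ ⟩
      sum (λ v → contract v (∂ a) τ)                            ≈⟨ sum-cong-≋ (λ v → contract-∂≈sum v a τ) ⟩
      sum (λ v → sum (λ u → contract v (contract u a) τ))       ≈⟨ sum²-antisym≈0 _ anti diag ⟩
      0#                                                        ∎
      where
      anti : ∀ v u → contract v (contract u a) τ ≈ - contract u (contract v a) τ
      anti v u = contract-anticomm u v a τ
      diag : ∀ v → contract v (contract v a) τ ≈ 0#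
      diag v = contract²≈0 a (x∈p∪⁅x⁆ τ v)

    Avoids⇒contract≋𝟘 : ∀ {v a} → Avoids v a → contract v a ≋ 𝟘
    Avoids⇒contract≋𝟘 {v} {a} avoids τ with lookup τ v
    ... | true  = ≈-refl
    ... | false = ≈-trans (*-congˡ (avoids _ (x∈p∪⁅x⁆ τ v))) (zeroʳ _)

    contract≋𝟘⇒Avoids : ∀ {v a} → contract v a ≋ 𝟘 → Avoids v a
    contract≋𝟘⇒Avoids {v} {a} contract≋𝟘 ρ v∈ρ = begin
      a ρ                                   ≈⟨ sgn-involutive (ρ - v) v (a ρ) ⟨
      sgn (ρ - v) v * (sgn (ρ - v) v * a ρ) ≡⟨ cong (λ σ → sgn (ρ - v) v * (sgn (ρ - v) v * a σ)) (p-x∪⁅x⁆≡p v∈ρ) ⟨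
      sgn (ρ - v) v * (sgn (ρ - v) v * a ((ρ - v) ∪ ⁅ v ⁆))
                                            ≡⟨ cong (sgn (ρ - v) v *_) (contract-∉ a (x∉p-x ρ v)) ⟨
      sgn (ρ - v) v * contract v a (ρ - v)  ≈⟨ *-congˡ (contract≋𝟘 (ρ - v)) ⟩
      sgn (ρ - v) v * 0#                    ≈⟨ zeroʳ _ ⟩
      0#                                    ∎

    contract-cone : ∀ {v a} → Avoids v a → contract v (cone v a) ≋ a
    contract-cone {v} {a} avoids τ with v ∈? τ
    ... | yes v∈τ = ≈-trans (reflexive (contract-∈ (cone v a) v∈τ)) (≈-sym (avoids τ v∈τ))
    ... | no  v∉τ = begin
      contract v (cone v a) τ                ≡⟨ contract-∉ (cone v a) v∉τ ⟩
      sgn τ v * cone v a (τ ∪ ⁅ v ⁆)         ≡⟨ cong (sgn τ v *_) (cone-∈ a (x∈p∪⁅x⁆ τ v)) ⟩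
      sgn τ v * (sgn τ′ v * a τ′)            ≡⟨ cong (λ σ → sgn τ v * (sgn σ v * a σ)) (p∪⁅x⁆-x≡p v∉τ) ⟩
      sgn τ v * (sgn τ v * a τ)              ≈⟨ sgn-involutive τ v (a τ) ⟩
      a τ                                    ∎
      where τ′ = (τ ∪ ⁅ v ⁆) - v

    ∂-cone : ∀ {v a} → Avoids v a → ∂ a ≋ 𝟘 → ∂ (cone v a) ≋ a
    ∂-cone {v} {a} avoids ∂a≋𝟘 τ with v ∈? τ
    ... | yes v∈τ = ≈-trans (contract≋𝟘⇒Avoids contract-∂cone≋𝟘 τ v∈τ) (≈-sym (avoids τ v∈τ))
      where
      contract-∂cone≋𝟘 : contract v (∂ (cone v a)) ≋ 𝟘
      contract-∂cone≋𝟘 σ = begin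
        contract v (∂ (cone v a)) σ  ≈⟨ contract-∂ v (cone v a) σ ⟩
        - ∂ (contract v (cone v a)) σ ≈⟨ -‿cong (∂-cong (contract-cone avoids) σ) ⟩
        - ∂ a σ                        ≈⟨ -≈0 (∂a≋𝟘 σ) ⟩
        0#                             ∎
    ... | no  v∉τ = begin
      ∂ (cone v a) τ                          ≈⟨ ∂≈sum-contract (cone v a) τ ⟩
      sum (λ u → contract u (cone v a) τ)     ≈⟨ sum-single _ v off-v ⟩
      contract v (cone v a) τ                 ≈⟨ contract-cone avoids τ ⟩
      a τ                                     ∎
      where
      off-v : ∀ u → u ≢ v → contract u (cone v a) τ ≈ 0#
      off-v u u≢v with lookup τ u
      ... | true  = ≈-refl
      ... | false = ≈-trans (*-congˡ (reflexive (cone-∉ a (x∉p∪⁅y⁆ v∉τ (u≢v ∘ sym))))) (zeroʳ _)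

    ∂[cone⊕⊖]≋𝟘 : ∀ {v w} a → Avoids v w → ∂ w ≋ 𝟘 → ∂ a ≋ w → ∂ (cone v w ⊕ ⊖ a) ≋ 𝟘
    ∂[cone⊕⊖]≋𝟘 {v} {w} a avoids ∂w≋𝟘 ∂a≋w τ = begin
      ∂ (cone v w ⊕ ⊖ a) τ          ≈⟨ ∂-⊕ (cone v w) (⊖ a) τ ⟩
      ∂ (cone v w) τ + ∂ (⊖ a) τ    ≈⟨ +-cong (∂-cone avoids ∂w≋𝟘 τ) (∂-⊖ a τ) ⟩
      w τ + - ∂ a τ                 ≈⟨ +-congˡ (-‿cong (∂a≋w τ)) ⟩
      w τ + - w τ                   ≈⟨ -‿inverseʳ (w τ) ⟩
      0#                            ∎

    ∂[⊖contract]≋ : ∀ {v w a} e → Avoids v w → Avoids v a → ∂ e ≋ cone v w ⊕ ⊖ a →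
                    ∂ (⊖ contract v e) ≋ w
    ∂[⊖contract]≋ {v} {w} {a} e avoids-w avoids-a ∂e≋ σ = begin
      ∂ (⊖ contract v e) σ                          ≈⟨ ∂-⊖ (contract v e) σ ⟩
      - ∂ (contract v e) σ                          ≈⟨ contract-∂ v e σ ⟨
      contract v (∂ e) σ                            ≈⟨ contract-cong v ∂e≋ σ ⟩
      contract v (cone v w ⊕ ⊖ a) σ                 ≈⟨ contract-⊕ v (cone v w) (⊖ a) σ ⟩
      contract v (cone v w) σ + contract v (⊖ a) σ  ≈⟨ +-cong (contract-cone avoids-w σ) (contract-⊖ v a σ) ⟩
      w σ + - contract v a σ                        ≈⟨ +-congˡ (-≈0 (Avoids⇒contract≋𝟘 avoids-a σ)) ⟩
      w σ + 0#                                      ≈⟨ +-identityʳ (w σ) ⟩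
      w σ                                           ∎

    ∂[contract]≋𝟘 : ∀ {v z} b → Avoids v z → ∂ b ≋ z → ∂ (contract v b) ≋ 𝟘
    ∂[contract]≋𝟘 {v} {z} b avoids ∂b≋z σ = begin
      ∂ (contract v b) σ        ≈⟨ -‿involutive _ ⟨
      - - ∂ (contract v b) σ    ≈⟨ -‿cong (contract-∂ v b σ) ⟨
      - contract v (∂ b) σ      ≈⟨ -‿cong (contract-cong v ∂b≋z σ) ⟩
      - contract v z σ          ≈⟨ -≈0 (Avoids⇒contract≋𝟘 avoids σ) ⟩
      0#                        ∎

    ∂[⊕∂]≋ : ∀ {z} b c → ∂ b ≋ z → ∂ (b ⊕ ∂ c) ≋ z
    ∂[⊕∂]≋ {z} b c ∂b≋z σ = begin
      ∂ (b ⊕ ∂ c) σ       ≈⟨ ∂-⊕ b (∂ c) σ ⟩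
      ∂ b σ + ∂ (∂ c) σ   ≈⟨ +-cong (∂b≋z σ) (∂∘∂≋𝟘 c σ) ⟩
      z σ + 0#            ≈⟨ +-identityʳ (z σ) ⟩
      z σ                 ∎

    Avoids-⊕∂cone : ∀ {v} u b → Avoids v u → ∂ u ≋ contract v b → Avoids v (b ⊕ ∂ (cone v u))
    Avoids-⊕∂cone {v} u b avoids ∂u≋ = contract≋𝟘⇒Avoids λ τ → begin
      contract v (b ⊕ ∂ (cone v u)) τ                   ≈⟨ contract-⊕ v b (∂ (cone v u)) τ ⟩
      contract v b τ + contract v (∂ (cone v u)) τ      ≈⟨ +-congˡ (contract-∂ v (cone v u) τ) ⟩
      contract v b τ + - ∂ (contract v (cone v u)) τ    ≈⟨ +-congˡ (-‿cong (∂-cong (contract-cone avoids) τ)) ⟩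
      contract v b τ + - ∂ u τ                          ≈⟨ +-congˡ (-‿cong (∂u≋ τ)) ⟩
      contract v b τ + - contract v b τ                 ≈⟨ -‿inverseʳ _ ⟩
      0#                                                ∎

    -- Deletion and link of a vertex

    deletion : SimplicialComplex n → Fin n → SimplicialComplex n
    deletion K v = induced K (∁ ⁅ v ⁆)

    infix 4 _⊑_
    _⊑_ : SimplicialComplex n → SimplicialComplex n → Set
    K ⊑ L = ∀ {ρ} → Face K ρ → Face L ρ

    link⊑deletion : ∀ {K v} → link K ⁅ v ⁆ ⊑ deletion K v
    link⊑deletion {K} {v} (face , disjoint) =
      downward K (p⊆p∪q ⁅ v ⁆) face , ∉⇒⊆∁⁅⁆ (Disjoint⁅⁆⇒∉ disjoint)

    IsChain-⊑ : ∀ {K L k a} → K ⊑ L → IsChain K k a → IsChain L k a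
    IsChain-⊑ K⊑L a∈K σ σ∉K = a∈K σ (λ (face , size) → σ∉K (K⊑L face , size))

    IsChain-⊕ : ∀ {K k a b} → IsChain K k a → IsChain K k b → IsChain K k (a ⊕ b)
    IsChain-⊕ a∈K b∈K σ σ∉K = ≈-trans (+-cong (a∈K σ σ∉K) (b∈K σ σ∉K)) (+-identityˡ 0#)

    IsChain-⊖ : ∀ {K k a} → IsChain K k a → IsChain K k (⊖ a)
    IsChain-⊖ a∈K σ σ∉K = -≈0 (a∈K σ σ∉K)

    IsChain-contract : ∀ {K L k a v} → (∀ {σ} → v ∉ σ → Face K (σ ∪ ⁅ v ⁆) → Face L σ) →
                       IsChain K (ℕ.suc k) a → IsChain L k (contract v a)
    IsChain-contract {K} {a = a} {v = v} coface a∈K σ σ∉L with v ∈? σ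
    ... | yes v∈σ = reflexive (contract-∈ a v∈σ)
    ... | no  v∉σ = ≈-trans (reflexive (contract-∉ a v∉σ)) (≈-trans (*-congˡ (a∈K _ σ∪v∉K)) (zeroʳ _))
      where
      σ∪v∉K : ¬ (Face K (σ ∪ ⁅ v ⁆) × ∣ σ ∪ ⁅ v ⁆ ∣ ≡ ℕ.suc _)
      σ∪v∉K (face , size) = σ∉L (coface v∉σ face , ℕ.suc-injective (trans (sym (∣p∪⁅x⁆∣≡1+∣p∣ v∉σ)) size))

    IsChain-∂ : ∀ {K k a} → IsChain K (ℕ.suc k) a → IsChain K k (∂ a)
    IsChain-∂ {K} {a = a} a∈K σ σ∉K = ≈-trans (∂≈sum-contract a σ)
      (sum-zero (λ v → IsChain-contract {K} {K} (λ _ → downward K (p⊆p∪q ⁅ v ⁆)) a∈K σ σ∉K))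

    IsChain-link-contract : ∀ {K k a v} → IsChain K (ℕ.suc k) a → IsChain (link K ⁅ v ⁆) k (contract v a)
    IsChain-link-contract {K} {v = v} =
      IsChain-contract {K} {link K ⁅ v ⁆} (λ v∉σ face → face , ∉⇒Disjoint⁅⁆ v∉σ)

    IsChain-cone : ∀ {K k a v} → IsChain (link K ⁅ v ⁆) k a → IsChain K (ℕ.suc k) (cone v a)
    IsChain-cone {K} {a = a} {v = v} a∈lk ρ ρ∉K with v ∈? ρ
    ... | no  v∉ρ = reflexive (cone-∉ a v∉ρ)
    ... | yes v∈ρ = ≈-trans (reflexive (cone-∈ a v∈ρ)) (≈-trans (*-congˡ (a∈lk _ ρ-v∉lk)) (zeroʳ _))
      where
      ρ-v∉lk : ¬ (Face (link K ⁅ v ⁆) (ρ - v) × ∣ ρ - v ∣ ≡ _)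
      ρ-v∉lk ((face , _) , size) =
        ρ∉K (subst (Face K) (p-x∪⁅x⁆≡p v∈ρ) face , trans (∣p∣≡1+∣p-x∣ v∈ρ) (cong ℕ.suc size))

    IsChain-link⇒Avoids : ∀ {K k a v} → IsChain (link K ⁅ v ⁆) k a → Avoids v a
    IsChain-link⇒Avoids a∈lk ρ v∈ρ = a∈lk ρ (λ ((_ , disjoint) , _) → Disjoint⁅⁆⇒∉ disjoint v∈ρ)

    IsChain-deletion⇒Avoids : ∀ {K k a v} → IsChain (deletion K v) k a → Avoids v a
    IsChain-deletion⇒Avoids a∈K-v ρ v∈ρ = a∈K-v ρ (λ ((_ , ρ⊆) , _) → ⊆∁⁅⁆⇒∉ ρ⊆ v∈ρ)

    IsChain-deletion : ∀ {K k a v} → IsChain K k a → Avoids v a → IsChain (deletion K v) k a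
    IsChain-deletion {a = a} {v = v} a∈K avoids ρ ρ∉K-v with v ∈? ρ
    ... | yes v∈ρ = avoids ρ v∈ρ
    ... | no  v∉ρ = a∈K ρ (λ (face , size) → ρ∉K-v ((face , ∉⇒⊆∁⁅⁆ v∉ρ) , size))

    -- w = ∂a in K ∖ v; the cycle cone v w − a of K bounds some e, and −contract v e bounds w.
    link-vanishes : ∀ {K v k} → ReducedHomologyVanishes K (ℕ.suc k) →
                    ReducedHomologyVanishes (deletion K v) k → ReducedHomologyVanishes (link K ⁅ v ⁆) k
    link-vanishes {K} {v} H-K H-K-v w w∈lk ∂w≋𝟘
      with H-K-v w (IsChain-⊑ {link K ⁅ v ⁆} {deletion K v} (link⊑deletion {K}) w∈lk) ∂w≋𝟘
    ... | a , a∈K-v , ∂a≋w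
      with H-K (cone v w ⊕ ⊖ a)
               (IsChain-⊕ {K} (IsChain-cone {K} {a = w} w∈lk)
                              (IsChain-⊖ {K} (IsChain-⊑ {deletion K v} {K} proj₁ a∈K-v)))
               (∂[cone⊕⊖]≋𝟘 a (IsChain-link⇒Avoids {K} w∈lk) ∂w≋𝟘 ∂a≋w)
    ... | e , e∈K , ∂e≋c =
      ⊖ contract v e , IsChain-⊖ {link K ⁅ v ⁆} (IsChain-link-contract {K} {a = e} e∈K) ,
      ∂[⊖contract]≋ e (IsChain-link⇒Avoids {K} w∈lk) (IsChain-deletion⇒Avoids {K} a∈K-v) ∂e≋c

    -- z = ∂b in K; contract v b is a cycle of the link, say ∂u, and b + ∂(cone v u) avoids v.
    deletion-vanishes : ∀ {K v k} → ReducedHomologyVanishes (link K ⁅ v ⁆) k →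
                        ReducedHomologyVanishes K k → ReducedHomologyVanishes (deletion K v) k
    deletion-vanishes {K} {v} H-lk H-K z z∈K-v ∂z≋𝟘
      with H-K z (IsChain-⊑ {deletion K v} {K} proj₁ z∈K-v) ∂z≋𝟘
    ... | b , b∈K , ∂b≋z
      with H-lk (contract v b) (IsChain-link-contract {K} {a = b} b∈K)
                (∂[contract]≋𝟘 b (IsChain-deletion⇒Avoids {K} z∈K-v) ∂b≋z)
    ... | u , u∈lk , ∂u≋ =
      b ⊕ ∂ (cone v u) ,
      IsChain-deletion {K} (IsChain-⊕ {K} b∈K (IsChain-∂ {K} {a = cone v u} (IsChain-cone {K} {a = u} u∈lk)))
                           (Avoids-⊕∂cone u b (IsChain-link⇒Avoids {K} u∈lk) ∂u≋) ,
      ∂[⊕∂]≋ b (cone v u) ∂b≋z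

    -- Relative links

    infix 4 _≃_
    record _≃_ (K L : SimplicialComplex n) : Set where
      constructor _,_
      field
        to   : K ⊑ L
        from : L ⊑ K

    ≃-sym : ∀ {K L} → K ≃ L → L ≃ K
    ≃-sym (K⊑L , L⊑K) = L⊑K , K⊑L

    ReducedHomologyVanishes-≃ : ∀ {K L k} → K ≃ L → ReducedHomologyVanishes K k → ReducedHomologyVanishes L k
    ReducedHomologyVanishes-≃ {K} {L} (K⊑L , L⊑K) H-K z z∈L ∂z≋𝟘 with H-K z (IsChain-⊑ {L} {K} L⊑K z∈L) ∂z≋𝟘
    ... | b , b∈K , ∂b≋z = b , IsChain-⊑ {K} {L} K⊑L b∈K , ∂b≋z

    VanishesFrom-≃ : ∀ {K L d} → K ≃ L → VanishesFrom K d → VanishesFrom L d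
    VanishesFrom-≃ K≃L H-K k d≤k-1 = ReducedHomologyVanishes-≃ K≃L (H-K k d≤k-1)

    VanishesFrom-link : ∀ K v {d} → VanishesFrom K d → VanishesFrom (deletion K v) d →
                        VanishesFrom (link K ⁅ v ⁆) d
    VanishesFrom-link K v H-K H-K-v k d≤k-1 =
      link-vanishes {K} (H-K (ℕ.suc k) (≤-step d≤k-1)) (H-K-v k d≤k-1)
      where
      ≤-step : ∀ {i k} → i ℤ.≤ ℤ.+ k ℤ.- ℤ.1ℤ → i ℤ.≤ ℤ.+ ℕ.suc k ℤ.- ℤ.1ℤ
      ≤-step {k = k} i≤k-1 = ℤ.≤-trans i≤k-1 (ℤ.+-monoˡ-≤ (ℤ.- ℤ.1ℤ) (ℤ.+≤+ (ℕ.n≤1+n k)))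

    VanishesFrom-deletion : ∀ K v {d} → VanishesFrom (link K ⁅ v ⁆) d → VanishesFrom K d →
                            VanishesFrom (deletion K v) d
    VanishesFrom-deletion K v H-lk H-K k d≤k-1 = deletion-vanishes {K} (H-lk k d≤k-1) (H-K k d≤k-1)

    relativeLink : SimplicialComplex n → Subset n → Subset n → SimplicialComplex n
    relativeLink X σ τ = link (induced X (∁ τ)) σ

    relativeLink-⊥ˡ : ∀ {X τ} → relativeLink X ⊥ τ ≃ induced X (∁ τ)
    relativeLink-⊥ˡ {X} {τ} =
      (λ {ρ} (face , _) → subst (Face (induced X (∁ τ))) (∪-identityʳ ρ) face) ,
      (λ {ρ} face → subst (Face (induced X (∁ τ))) (sym (∪-identityʳ ρ)) face , Disjoint⁺ λ _ → ∉⊥)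

    relativeLink-⊥ʳ : ∀ {X σ} → relativeLink X σ ⊥ ≃ link X σ
    relativeLink-⊥ʳ =
      (λ ((face , _) , disjoint) → face , disjoint) ,
      (λ (face , disjoint) → (face , λ _ → x∉p⇒x∈∁p ∉⊥) , disjoint)

    relativeLink-∪ʳ : ∀ {X σ τ v} → v ∉ σ → relativeLink X σ (τ ∪ ⁅ v ⁆) ≃ deletion (relativeLink X σ τ) v
    relativeLink-∪ʳ {X} {σ} {τ} {v} v∉σ =
      (λ ((face , ⊆∁τ∪v) , disjoint) →
         ((face , λ x∈ → ∁τ∪v⊆∁τ (⊆∁τ∪v x∈)) , disjoint) , λ x∈ρ → ∁τ∪v⊆∁v (⊆∁τ∪v (p⊆p∪q σ x∈ρ))) ,
      (λ (((face , ⊆∁τ) , disjoint) , ρ⊆∁v) →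
         (face , ⊆∁∪ ⊆∁τ (∪⊆ ρ⊆∁v (∉⇒⊆∁⁅⁆ v∉σ))) , disjoint)
      where
      ∁τ∪v⊆∁τ : ∁ (τ ∪ ⁅ v ⁆) ⊆ ∁ τ
      ∁τ∪v⊆∁τ = p⊆q⇒∁p⊇∁q (p⊆p∪q ⁅ v ⁆)
      ∁τ∪v⊆∁v : ∁ (τ ∪ ⁅ v ⁆) ⊆ ∁ ⁅ v ⁆
      ∁τ∪v⊆∁v = p⊆q⇒∁p⊇∁q (q⊆p∪q τ ⁅ v ⁆)

    relativeLink-∪ˡ : ∀ {X σ τ v} → v ∉ σ → relativeLink X (σ ∪ ⁅ v ⁆) τ ≃ link (relativeLink X σ τ) ⁅ v ⁆
    relativeLink-∪ˡ {X} {σ} {τ} {v} v∉σ =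
      (λ {ρ} (face , disjoint) →
         (subst (Face (induced X (∁ τ))) (regroup ρ) face ,
          Disjoint⁺ λ x∈ρ∪v x∈σ → case x∈p∪q⁻ ρ ⁅ v ⁆ x∈ρ∪v of λ where
            (inj₁ x∈ρ) → Disjoint⁻ disjoint x∈ρ (p⊆p∪q ⁅ v ⁆ x∈σ)
            (inj₂ x∈v) → v∉σ (subst (_∈ σ) (x∈⁅y⁆⇒x≡y v x∈v) x∈σ)) ,
         Disjoint⁺ λ x∈ρ x∈v → Disjoint⁻ disjoint x∈ρ (q⊆p∪q σ ⁅ v ⁆ x∈v)) ,
      (λ {ρ} ((face , disjoint) , disjoint-v) →
         subst (Face (induced X (∁ τ))) (sym (regroup ρ)) face ,
         Disjoint⁺ λ x∈ρ x∈σ∪v → case x∈p∪q⁻ σ ⁅ v ⁆ x∈σ∪v of λ where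
           (inj₁ x∈σ) → Disjoint⁻ disjoint (p⊆p∪q ⁅ v ⁆ x∈ρ) x∈σ
           (inj₂ x∈v) → Disjoint⁻ disjoint-v x∈ρ x∈v)
      where
      regroup : ∀ ρ → ρ ∪ (σ ∪ ⁅ v ⁆) ≡ (ρ ∪ ⁅ v ⁆) ∪ σ
      regroup ρ = trans (sym (∪-assoc ρ σ ⁅ v ⁆)) (∪-swapʳ ρ σ ⁅ v ⁆)

    module _ {X Y : SimplicialComplex n} {d : ℤ} where

      LerayBound⇒relativeLink : LerayBound Y X d → ∀ m {σ τ} → ∣ σ ∣ ≡ m → Face Y (σ ∪ τ) →
                                VanishesFrom (relativeLink X σ τ) d
      LerayBound⇒relativeLink leray m {σ} {τ} size face with nonempty? σ
      ... | no σ-empty rewrite Empty-unique σ-empty =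
        VanishesFrom-≃ (≃-sym (relativeLink-⊥ˡ {X})) (leray τ (downward Y (q⊆p∪q _ τ) face))
      ... | yes (v , v∈σ) with m
      ...   | ℕ.zero  = ⊥-elim (ℕ.0≢1+n (trans (sym size) (∣p∣≡1+∣p-x∣ v∈σ)))
      ...   | ℕ.suc m =
        subst (λ π → VanishesFrom (relativeLink X π τ) d) (p-x∪⁅x⁆≡p v∈σ)
          (VanishesFrom-≃ (≃-sym (relativeLink-∪ˡ {X} (x∉p-x σ v)))
            (VanishesFrom-link (relativeLink X (σ - v) τ) v H-K H-K-v))
        where
        σ-v⊆σ∪τ : σ - v ⊆ σ ∪ τ
        σ-v⊆σ∪τ x∈ = p⊆p∪q τ (p─q⊆p σ ⁅ v ⁆ x∈)
        v⊆σ∪τ : ⁅ v ⁆ ⊆ σ ∪ τ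
        v⊆σ∪τ x∈v = p⊆p∪q τ (subst (_∈ σ) (sym (x∈⁅y⁆⇒x≡y v x∈v)) v∈σ)
        IH : ∀ {τ′} → (σ - v) ∪ τ′ ⊆ σ ∪ τ → VanishesFrom (relativeLink X (σ - v) τ′) d
        IH ⊆σ∪τ =
          LerayBound⇒relativeLink leray m (ℕ.suc-injective (trans (sym (∣p∣≡1+∣p-x∣ v∈σ)) size))
                                  (downward Y ⊆σ∪τ face)
        H-K : VanishesFrom (relativeLink X (σ - v) τ) d
        H-K = IH (∪⊆ σ-v⊆σ∪τ (q⊆p∪q σ τ))
        H-K-v : VanishesFrom (deletion (relativeLink X (σ - v) τ) v) d
        H-K-v = VanishesFrom-≃ (relativeLink-∪ʳ {X} (x∉p-x σ v)) (IH (∪⊆ σ-v⊆σ∪τ (∪⊆ (q⊆p∪q σ τ) v⊆σ∪τ)))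

      LinkBound⇒relativeLink : LinkBound Y X d → ∀ m {σ τ} → ∣ τ ∣ ≡ m → Disjoint σ τ → Face Y (σ ∪ τ) →
                               VanishesFrom (relativeLink X σ τ) d
      LinkBound⇒relativeLink link-bound m {σ} {τ} size disjoint face with nonempty? τ
      ... | no τ-empty rewrite Empty-unique τ-empty =
        VanishesFrom-≃ (≃-sym (relativeLink-⊥ʳ {X})) (link-bound σ (downward Y (p⊆p∪q _) face))
      ... | yes (v , v∈τ) with m
      ...   | ℕ.zero  = ⊥-elim (ℕ.0≢1+n (trans (sym size) (∣p∣≡1+∣p-x∣ v∈τ)))
      ...   | ℕ.suc m =
        subst (λ π → VanishesFrom (relativeLink X σ π) d) (p-x∪⁅x⁆≡p v∈τ)
          (VanishesFrom-≃ (≃-sym (relativeLink-∪ʳ {X} v∉σ))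
            (VanishesFrom-deletion (relativeLink X σ (τ - v)) v H-lk H-K))
        where
        v∉σ : v ∉ σ
        v∉σ v∈σ = Disjoint⁻ disjoint v∈σ v∈τ
        τ-v⊆σ∪τ : τ - v ⊆ σ ∪ τ
        τ-v⊆σ∪τ x∈ = q⊆p∪q σ τ (p─q⊆p τ ⁅ v ⁆ x∈)
        v⊆σ∪τ : ⁅ v ⁆ ⊆ σ ∪ τ
        v⊆σ∪τ x∈v = q⊆p∪q σ τ (subst (_∈ τ) (sym (x∈⁅y⁆⇒x≡y v x∈v)) v∈τ)
        disjoint-τ-v : Disjoint σ (τ - v)
        disjoint-τ-v = Disjoint⁺ λ x∈σ x∈τ-v → Disjoint⁻ disjoint x∈σ (p─q⊆p τ ⁅ v ⁆ x∈τ-v)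
        disjoint-v : Disjoint (σ ∪ ⁅ v ⁆) (τ - v)
        disjoint-v = Disjoint⁺ λ x∈σ∪v x∈τ-v → case x∈p∪q⁻ σ ⁅ v ⁆ x∈σ∪v of λ where
          (inj₁ x∈σ) → Disjoint⁻ disjoint x∈σ (p─q⊆p τ ⁅ v ⁆ x∈τ-v)
          (inj₂ x∈v) → x∉p-x τ v (subst (_∈ τ - v) (x∈⁅y⁆⇒x≡y v x∈v) x∈τ-v)
        IH : ∀ {σ′} → Disjoint σ′ (τ - v) → σ′ ∪ (τ - v) ⊆ σ ∪ τ →
             VanishesFrom (relativeLink X σ′ (τ - v)) d
        IH disjoint′ ⊆σ∪τ =
          LinkBound⇒relativeLink link-bound m (ℕ.suc-injective (trans (sym (∣p∣≡1+∣p-x∣ v∈τ)) size))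
                                 disjoint′ (downward Y ⊆σ∪τ face)
        H-lk : VanishesFrom (link (relativeLink X σ (τ - v)) ⁅ v ⁆) d
        H-lk = VanishesFrom-≃ (relativeLink-∪ˡ {X} v∉σ) (IH disjoint-v (∪⊆ (∪⊆ (p⊆p∪q τ) v⊆σ∪τ) τ-v⊆σ∪τ))
        H-K : VanishesFrom (relativeLink X σ (τ - v)) d
        H-K = IH disjoint-τ-v (∪⊆ (p⊆p∪q τ) τ-v⊆σ∪τ)

      LerayBound⇒LinkBound : LerayBound Y X d → LinkBound Y X d
      LerayBound⇒LinkBound leray σ face =
        VanishesFrom-≃ (relativeLink-⊥ʳ {X})
          (LerayBound⇒relativeLink leray _ refl (subst (Face Y) (sym (∪-identityʳ σ)) face))

      LinkBound⇒LerayBound : LinkBound Y X d → LerayBound Y X d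
      LinkBound⇒LerayBound link-bound τ face =
        VanishesFrom-≃ (relativeLink-⊥ˡ {X})
          (LinkBound⇒relativeLink link-bound _ refl (Disjoint⁺ λ x∈⊥ _ → ∉⊥ x∈⊥)
                                  (subst (Face Y) (sym (∪-identityˡ τ)) face))

proposition2p1 : ∀ {c ℓ} (F : Field c ℓ) (n : ℕ) (X Y : SimplicialComplex n) (d : ℤ) →
    (Chains.LerayBound F Y X d → Chains.LinkBound F Y X d) ×
    (Chains.LinkBound F Y X d → Chains.LerayBound F Y X d)
proposition2p1 F n X Y d = LerayBound⇒LinkBound {X = X} {Y} , LinkBound⇒LerayBound {X = X} {Y}
  where open Boundary F
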